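{- Let $k\ge 4$ and let $G=(V,E)$ be a $k$-regular bipartite graph with $n$ vertices. Let $M_1,\dots,M_k$ be edge-disjoint perfect matchings of $G$ obtained as follows: $G_0=G$, and for $i=1,\dots,k$, $M_i$ is any perfect matching of $G_{i-1}$ and $G_i=G_{i-1}\setminus M_i$. Let $G_{cubic}$ be the graph $(V, M_1\cup M_2\cup M_i)$ for an index $i\in\{3,\dots,k\}$ minimizing the number of connected components of $(V,M_1\cup M_2\cup M_i)$ that are isomorphic to $K_{3,3}$. Then $G_{cubic}$ has at most $\frac{n}{6(k-2)}$ connected components isomorphic to $K_{3,3}$.
   Context: A graph is $k$-regular if every vertex has degree $k$. Since $G_{i-1}$ is a $(k-i+1)$-regular bipartite graph, a perfect matching $M_i$ exists at each step. $K_{3,3}$ denotes the complete bipartite graph with two sides of size $3$. -}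

module Defs where

open import Data.Nat using (ℕ; zero; suc; _≤_; _<_; _<ᵇ_; pred)
open import Data.Bool using (Bool; true; false; _∨_; _xor_)
open import Data.Fin using (Fin; toℕ)
open import Data.Fin.Subset using (Subset; ∣_∣; _∈_)
open import Data.Vec using (tabulate; lookup)
open import Data.List using (List; length)
open import Data.List.Relation.Unary.Unique.Propositional using (Unique)
import Data.List.Membership.Propositional as LM
open import Data.Product using (Σ; ∃; _×_; _,_)
open import Data.Empty using (⊥)
open import Relation.Binary.PropositionalEquality using (_≡_; _≢_)
open import Function.Bundles using (_⇔_)

-- A (decidable) edge relation on the vertex set Fin n.
-- Graphs and edge sets (e.g. matchings) are both represented this way.
Rel : ℕ → Set
Rel n = Fin n → Fin n → Bool

IsSimple : ∀ {n} → Rel n → Set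
IsSimple {n} E = (∀ u v → E u v ≡ E v u) × (∀ u → E u u ≡ false)

degree : ∀ {n} → Rel n → Fin n → ℕ
degree E v = ∣ tabulate (E v) ∣

Regular : ∀ {n} → ℕ → Rel n → Set
Regular k E = ∀ v → degree E v ≡ k

Bipartite : ∀ {n} → Rel n → Set
Bipartite {n} E = Σ (Fin n → Bool) λ c → ∀ u v → E u v ≡ true → c u ≢ c v

IsPerfectMatchingOf : ∀ {n} → Rel n → Rel n → Set
IsPerfectMatchingOf {n} H M =
  (∀ u v → M u v ≡ M v u) × (∀ u v → M u v ≡ true → H u v ≡ true) × (∀ v → degree M v ≡ 1)

-- G minus edge sets M_1,...,M_{i-1}:  G_{i-1} in the paper (G_0 = G).
Remaining : ∀ {n} → Rel n → (ℕ → Rel n) → ℕ → Rel n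
Remaining G M zero    u v = G u v
Remaining G M (suc i) u v with M (suc i) u v
... | true  = false
... | false = Remaining G M i u v

IsMatchingSequence : ∀ {n} → ℕ → Rel n → (ℕ → Rel n) → Set
IsMatchingSequence k G M =
  ∀ i → 1 ≤ i → i ≤ k → IsPerfectMatchingOf (Remaining G M (pred i)) (M i)

union3 : ∀ {n} → Rel n → Rel n → Rel n → Rel n
union3 A B C u v = A u v ∨ B u v ∨ C u v

data Reachable {n} (H : Rel n) : Fin n → Fin n → Set where
  here : ∀ {u} → Reachable H u u
  step : ∀ {u v w} → H u v ≡ true → Reachable H v w → Reachable H u w

IsComponent : ∀ {n} → Rel n → Subset n → Set
IsComponent {n} H S =
  (∃ λ v → v ∈ S)
  × (∀ u v → u ∈ S → H u v ≡ true → v ∈ S)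
  × (∀ u v → u ∈ S → v ∈ S → Reachable H u v)

side : Fin 6 → Bool
side a = toℕ a <ᵇ 3

K33 : Rel 6
K33 a b = side a xor side b

InducedIsoK33 : ∀ {n} → Rel n → Subset n → Set
InducedIsoK33 {n} H S =
  Σ (Fin 6 → Fin n) λ f →
    (∀ a b → f a ≡ f b → a ≡ b)
    × (∀ v → v ∈ S → ∃ λ a → f a ≡ v)
    × (∀ a → f a ∈ S)
    × (∀ a b → H (f a) (f b) ≡ K33 a b)

IsK33Component : ∀ {n} → Rel n → Subset n → Set
IsK33Component H S = IsComponent H S × InducedIsoK33 H S

NumK33Components : ∀ {n} → Rel n → ℕ → Set
NumK33Components {n} H c =
  Σ (List (Subset n)) λ L →
    Unique L × length L ≡ c × (∀ S → (S LM.∈ L) ⇔ IsK33Component H S)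

module Submission where

-- Write H_j = M_1 ∪ M_2 ∪ M_j for 3 ≤ j ≤ k.  The
-- crucial local fact is: if A and B are disjoint perfect matchings of
-- K_{3,3}, then A ∪ B is a Hamiltonian 6-cycle, and the alternating path
-- p -A- q -B- r -A- s ends at the vertex antipodal to p, so the edge ps
-- (which lies in K_{3,3} but in neither A nor B) must belong to any C with
-- K_{3,3} ⊆ A ∪ B ∪ C.  Consequently, if v lies in a K_{3,3}-component of
-- H_j, then the M_1-M_2-M_1 path v a r s forces vs ∈ M_j.  Since the M_j are
-- pairwise disjoint, the index j is determined by v: K_{3,3}-components of
-- different H_j are vertex-disjoint.  Each H_j (3 ≤ j ≤ k) has at least
-- c = cnt i such components, each with 6 vertices, all pairwise disjoint,
-- which gives an injection Fin 6 × Fin (k-2) × Fin c → V, hence the bound.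

open import Defs
open import Data.Nat using (ℕ; zero; suc; _≤_; _<_; _*_; _∸_; _+_; z≤n; s≤s; pred)
open import Data.Nat.Properties
  using (≤-trans; <-cmp; m≤n⇒m<n∨m≡n; m≤m+n; +-monoʳ-≤; m+[n∸m]≡n; +-cancelˡ-≡)
open import Data.Bool using (Bool; true; false; _xor_)
open import Data.Bool.Properties using (∨-zeroʳ) renaming (_≟_ to _≟ᵇ_)
open import Data.Fin using (Fin; toℕ; _≟_; inject≤; remQuot; combine)
  renaming (zero to fzero; suc to fsuc)
open import Data.Fin.Properties
  using (all?; any?; toℕ<n; toℕ-injective; inject≤-injective; injective⇒≤; combine-remQuot)
open import Data.Fin.Subset using (Subset; _∈_; ∣_∣)
open import Data.Fin.Subset.Properties using (⊆-antisym)
open import Data.Vec using (tabulate)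
open import Data.List using (List; _∷_; length; lookup)
import Data.List.Relation.Unary.All as All
open import Data.List.Relation.Unary.AllPairs using (_∷_)
open import Data.List.Relation.Unary.Unique.Propositional using (Unique)
open import Data.List.Membership.Propositional.Properties using (∈-lookup)
open import Data.Product using (∃; _×_; _,_; proj₁; proj₂; uncurry)
open import Data.Sum using (_⊎_; inj₁; inj₂)
open import Data.Empty using (⊥; ⊥-elim)
open import Data.Unit using (tt)
open import Relation.Nullary.Decidable using (toWitness; _→-dec_; _×-dec_; ¬?)
open import Relation.Binary.PropositionalEquality
open import Relation.Binary.Definitions using (tri<; tri≈; tri>)
open import Function.Bundles using (Equivalence)

-- Finite facts about K_{3,3}, checked by exhaustive evaluation.  They are
-- abstract so that the evaluated proofs are never unfolded later on.

abstract
  -- Adjacency in K_{3,3} is "different sides", so it composes like xor.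
  K33-xor : ∀ a b c → K33 a c ≡ K33 a b xor K33 b c
  K33-xor = toWitness {a? = all? λ a → all? λ b → all? λ c →
    K33 a c ≟ᵇ (K33 a b xor K33 b c)} tt

  K33-sym : ∀ a b → K33 a b ≡ K33 b a
  K33-sym = toWitness {a? = all? λ a → all? λ b → K33 a b ≟ᵇ K33 b a} tt

  thirdVertex : ∀ x y → K33 x y ≡ false → x ≢ y →
    ∃ λ z → (K33 x z ≡ false × z ≢ x × z ≢ y)
          × (∀ w → K33 x w ≡ false → w ≢ x → w ≢ y → w ≡ z)
  thirdVertex = toWitness {a? = all? λ x → all? λ y →
    (K33 x y ≟ᵇ false) →-dec ¬? (x ≟ y) →-dec any? λ z →
      ((K33 x z ≟ᵇ false) ×-dec ¬? (z ≟ x) ×-dec ¬? (z ≟ y))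
      ×-dec all? λ w → (K33 x w ≟ᵇ false) →-dec ¬? (w ≟ x) →-dec ¬? (w ≟ y) →-dec (w ≟ z)} tt

K33-via : ∀ a b c {x y} → K33 a b ≡ x → K33 b c ≡ y → K33 a c ≡ x xor y
K33-via a b c e₁ e₂ = trans (K33-xor a b c) (cong₂ _xor_ e₁ e₂)

union-inj₁ : ∀ {n} (A B C : Rel n) {u v} → A u v ≡ true → union3 A B C u v ≡ true
union-inj₁ A B C e rewrite e = refl

union-inj₂ : ∀ {n} (A B C : Rel n) {u v} → B u v ≡ true → union3 A B C u v ≡ true
union-inj₂ A B C {u} e rewrite e = ∨-zeroʳ (A u _)

union-cases : ∀ {n} (A B C : Rel n) {u v} → union3 A B C u v ≡ true
  → A u v ≡ true ⊎ B u v ≡ true ⊎ C u v ≡ true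
union-cases A B C {u} {v} e with A u v | B u v
... | true  | _     = inj₁ refl
... | false | true  = inj₂ (inj₁ refl)
... | false | false = inj₂ (inj₂ e)

record IsMatchingRel {n} (X : Rel n) : Set where
  field
    symmetric  : ∀ u v → X u v ≡ X v u
    total      : ∀ u → ∃ λ v → X u v ≡ true
    functional : ∀ {u v w} → X u v ≡ true → X u w ≡ true → v ≡ w

  reverse : ∀ {u v} → X u v ≡ true → X v u ≡ true
  reverse {u} {v} e = trans (symmetric v u) e

  distinct-partners : ∀ {u a w b} → u ≢ a → X u w ≡ true → X a b ≡ true → w ≢ b
  distinct-partners u≢a uw ab refl = u≢a (functional (reverse uw) (reverse ab))

count-zero : ∀ {m} (P : Fin m → Bool) → ∣ tabulate P ∣ ≡ 0 → ∀ x → P x ≡ false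
count-zero {suc m} P none x with P fzero in e
count-zero {suc m} P ()   x        | true
count-zero {suc m} P none fzero    | false = e
count-zero {suc m} P none (fsuc x) | false = count-zero (λ y → P (fsuc y)) none x

count-one : ∀ {m} (P : Fin m → Bool) → ∣ tabulate P ∣ ≡ 1
  → ∃ λ x → P x ≡ true × (∀ y → P y ≡ true → y ≡ x)
count-one {suc m} P one with P fzero in e
... | true = fzero , e , only-zero
  where
  only-zero : ∀ y → P y ≡ true → y ≡ fzero
  only-zero fzero    _  = refl
  only-zero (fsuc y) Py with trans (sym Py) (count-zero (λ z → P (fsuc z)) (cong pred one) y)
  ... | ()
... | false with count-one (λ y → P (fsuc y)) one
... | x , Px , unique = fsuc x , Px , only-x
  where
  only-x : ∀ y → P y ≡ true → y ≡ fsuc x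
  only-x fzero Py with trans (sym Py) e
  ... | ()
  only-x (fsuc y) Py = cong fsuc (unique y Py)

degree-one⇒matching : ∀ {n} {M : Rel n} → (∀ u v → M u v ≡ M v u)
  → (∀ v → degree M v ≡ 1) → IsMatchingRel M
degree-one⇒matching {M = M} sym-M deg = record
  { symmetric  = sym-M
  ; total      = λ u → let (v , e , _) = count-one (M u) (deg u) in v , e
  ; functional = λ {u} e₁ e₂ → let (_ , _ , unique) = count-one (M u) (deg u) in
                   trans (unique _ e₁) (sym (unique _ e₂))
  }

pullback-matching : ∀ {m n} (f : Fin m → Fin n) → (∀ a b → f a ≡ f b → a ≡ b)
  → (X : Rel n) → IsMatchingRel X
  → (∀ a v → X (f a) v ≡ true → ∃ λ b → f b ≡ v)
  → IsMatchingRel (λ a b → X (f a) (f b))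
pullback-matching f f-inj X mX closed = record
  { symmetric  = λ a b → symmetric (f a) (f b)
  ; total      = total′
  ; functional = λ e₁ e₂ → f-inj _ _ (functional e₁ e₂)
  }
  where
  open IsMatchingRel mX
  total′ : ∀ a → ∃ λ b → X (f a) (f b) ≡ true
  total′ a with total (f a)
  ... | v , e with closed a v e
  ... | b , refl = b , e

alternating-K33 : (A B C : Rel 6) → IsMatchingRel A → IsMatchingRel B
  → (∀ {p q} → A p q ≡ true → K33 p q ≡ true)
  → (∀ {p q} → B p q ≡ true → K33 p q ≡ true)
  → (∀ {p q} → A p q ≡ true → B p q ≡ true → ⊥)
  → (∀ {p q} → K33 p q ≡ true → A p q ≡ true ⊎ B p q ≡ true ⊎ C p q ≡ true)
  → ∀ {p q r s} → A p q ≡ true → B q r ≡ true → A r s ≡ true → C p s ≡ true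
alternating-K33 A B C mA mB A⊆K B⊆K disjoint covers {p} {q} {r} {s} apq bqr ars =
  C-edge (covers p~s)
  where
  module A = IsMatchingRel mA
  module B = IsMatchingRel mB

  p≁r : K33 p r ≡ false
  p≁r = K33-via p q r (A⊆K apq) (B⊆K bqr)
  p~s : K33 p s ≡ true
  p~s = K33-via p r s p≁r (A⊆K ars)
  q~p : K33 q p ≡ true
  q~p = trans (K33-sym q p) (A⊆K apq)
  q≁s : K33 q s ≡ false
  q≁s = K33-via q p s q~p p~s

  p≢r : p ≢ r
  p≢r p≡r = disjoint apq (B.reverse (subst (λ x → B q x ≡ true) (sym p≡r) bqr))
  q≢s : q ≢ s
  q≢s = A.distinct-partners p≢r apq ars

  no-A-edge : A p s ≡ true → ⊥
  no-A-edge aps = q≢s (A.functional apq aps)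

  -- If B p s held, p q r s would be a 4-cycle of A ∪ B, and the third
  -- vertex u on p's side would have both partners at the third vertex on
  -- q's side, contradicting disjointness of A and B.
  no-B-edge : B p s ≡ true → ⊥
  no-B-edge bps =
    let (u , (p≁u , u≢p , u≢r) , _) = thirdVertex p r p≁r p≢r
    in  same-partner p≁u u≢p u≢r (proj₂ (A.total u)) (proj₂ (B.total u))
    where
    same-partner : ∀ {u w w′} → K33 p u ≡ false → u ≢ p → u ≢ r
      → A u w ≡ true → B u w′ ≡ true → ⊥
    same-partner {u} {w} {w′} p≁u u≢p u≢r auw buw′ =
      disjoint auw (subst (λ x → B u x ≡ true) (sym w≡w′) buw′)
      where
      q-side : ∀ x → K33 u x ≡ true → K33 q x ≡ false
      q-side x u~x = K33-via q p x q~p (K33-via p u x p≁u u~x)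
      w≡w′ : w ≡ w′
      w≡w′ =
        let (_ , _ , unique) = thirdVertex q s q≁s q≢s
        in  trans (unique w (q-side w (A⊆K auw))
                    (A.distinct-partners u≢p auw apq) (A.distinct-partners u≢r auw ars))
              (sym (unique w′ (q-side w′ (B⊆K buw′))
                    (B.distinct-partners u≢r buw′ (B.reverse bqr))
                    (B.distinct-partners u≢p buw′ bps)))

  C-edge : A p s ≡ true ⊎ B p s ≡ true ⊎ C p s ≡ true → C p s ≡ true
  C-edge (inj₁ aps)        = ⊥-elim (no-A-edge aps)
  C-edge (inj₂ (inj₁ bps)) = ⊥-elim (no-B-edge bps)
  C-edge (inj₂ (inj₂ cps)) = cps

-- The same statement inside a K_{3,3}-component of an arbitrary graph
-- A ∪ B ∪ C, obtained by pulling everything back along the isomorphism.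
alternating-path : ∀ {n} (A B C : Rel n) → IsMatchingRel A → IsMatchingRel B
  → (∀ {u v} → A u v ≡ true → B u v ≡ true → ⊥)
  → ∀ {S} → IsK33Component (union3 A B C) S
  → ∀ {v a r s} → v ∈ S → A v a ≡ true → B a r ≡ true → A r s ≡ true → C v s ≡ true
alternating-path A B C mA mB disjoint ((_ , closed , _) , f , f-inj , onto , f∈S , f-iso) v∈S =
  lift (onto _ v∈S)
  where
  pull : Rel _ → Rel 6
  pull X p q = X (f p) (f q)

  -- The component is closed, so neighbours of its vertices have preimages.
  neighbour : ∀ p x → union3 A B C (f p) x ≡ true → ∃ λ q → f q ≡ x
  neighbour p x e = onto x (closed (f p) x (f∈S p) e)

  path-in-K33 : ∀ {p q r s} → pull A p q ≡ true → pull B q r ≡ true → pull A r s ≡ true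
    → pull C p s ≡ true
  path-in-K33 = alternating-K33 (pull A) (pull B) (pull C)
    (pullback-matching f f-inj A mA (λ p x e → neighbour p x (union-inj₁ A B C e)))
    (pullback-matching f f-inj B mB (λ p x e → neighbour p x (union-inj₂ A B C e)))
    (λ {p} {q} e → trans (sym (f-iso p q)) (union-inj₁ A B C e))
    (λ {p} {q} e → trans (sym (f-iso p q)) (union-inj₂ A B C e))
    disjoint
    (λ {p} {q} k → union-cases A B C (trans (f-iso p q) k))

  lift : ∀ {v a r s} → ∃ (λ p → f p ≡ v)
    → A v a ≡ true → B a r ≡ true → A r s ≡ true → C v s ≡ true
  lift {a = a} {r} {s} (p , refl) va ar rs
    with neighbour p a (union-inj₁ A B C va)
  ... | q , refl with neighbour q r (union-inj₂ A B C ar)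
  ... | r′ , refl with neighbour r′ s (union-inj₁ A B C rs)
  ... | s′ , refl = path-in-K33 va ar rs

reach-closed : ∀ {n} (H : Rel n) (S : Subset n) → (∀ u v → u ∈ S → H u v ≡ true → v ∈ S)
  → ∀ {x y} → x ∈ S → Reachable H x y → y ∈ S
reach-closed H S closed x∈S here = x∈S
reach-closed H S closed x∈S (step {u} {v} e path) = reach-closed H S closed (closed u v x∈S e) path

same-component : ∀ {n} {H : Rel n} {S S′ : Subset n} → IsComponent H S → IsComponent H S′
  → ∀ {v} → v ∈ S → v ∈ S′ → S ≡ S′
same-component {H = H} {S} {S′} (_ , closed , connected) (_ , closed′ , connected′) {v} v∈S v∈S′ =
  ⊆-antisym (λ {x} x∈S → reach-closed H S′ closed′ v∈S′ (connected v x v∈S x∈S))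
            (λ {x} x∈S′ → reach-closed H S closed v∈S (connected′ v x v∈S′ x∈S′))

lookup-injective : ∀ {A : Set} (xs : List A) → Unique xs
  → ∀ i j → lookup xs i ≡ lookup xs j → i ≡ j
lookup-injective (x ∷ xs) (x∉xs ∷ u) fzero    fzero    e = refl
lookup-injective (x ∷ xs) (x∉xs ∷ u) fzero    (fsuc j) e = ⊥-elim (All.lookup x∉xs (∈-lookup j) e)
lookup-injective (x ∷ xs) (x∉xs ∷ u) (fsuc i) fzero    e = ⊥-elim (All.lookup x∉xs (∈-lookup i) (sym e))
lookup-injective (x ∷ xs) (x∉xs ∷ u) (fsuc i) (fsuc j) e = cong fsuc (lookup-injective xs u i j e)

remQuot-injective : ∀ {a} b {x y : Fin (a * b)} → remQuot {a} b x ≡ remQuot b y → x ≡ y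
remQuot-injective {a} b {x} {y} e = begin
  x                                 ≡⟨ combine-remQuot {a} b x ⟨
  uncurry combine (remQuot {a} b x) ≡⟨ cong (uncurry combine) e ⟩
  uncurry combine (remQuot {a} b y) ≡⟨ combine-remQuot {a} b y ⟩
  y                                 ∎
  where open ≡-Reasoning

injective₃⇒≤ : ∀ {a b c n} (f : Fin a → Fin b → Fin c → Fin n)
  → (∀ {x y z x′ y′ z′} → f x y z ≡ f x′ y′ z′ → x ≡ x′ × y ≡ y′ × z ≡ z′)
  → a * b * c ≤ n
injective₃⇒≤ {a} {b} {c} {n} f f-inj = injective⇒≤ {f = g} g-inj
  where
  g : Fin (a * b * c) → Fin n
  g i = let (xy , z) = remQuot c i ; (x , y) = remQuot b xy in f x y z
  g-inj : ∀ {i j} → g i ≡ g j → i ≡ j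
  g-inj e =
    let (x≡ , y≡ , z≡) = f-inj e
    in  remQuot-injective c (cong₂ _,_ (remQuot-injective b (cong₂ _,_ x≡ y≡)) z≡)

module MatchingSequence {n} (k : ℕ) (G : Rel n) (M : ℕ → Rel n)
                        (seq : IsMatchingSequence k G M) where

  matching : ∀ {i} → 1 ≤ i → i ≤ k → IsMatchingRel (M i)
  matching 1≤i i≤k = let (sym-M , _ , deg) = seq _ 1≤i i≤k in degree-one⇒matching sym-M deg

  removed : ∀ m {i u v} → 1 ≤ i → i ≤ m → M i u v ≡ true → Remaining G M m u v ≡ false
  removed zero    {suc _} _ () _
  removed (suc m) {i} {u} {v} 1≤i i≤m+1 e with M (suc m) u v in e′
  ... | true = refl
  ... | false with m≤n⇒m<n∨m≡n i≤m+1
  ...   | inj₁ (s≤s i≤m) = removed m 1≤i i≤m e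
  ...   | inj₂ refl with trans (sym e) e′
  ...     | ()

  disjoint : ∀ {i j u v} → 1 ≤ i → i < j → j ≤ k → M i u v ≡ true → M j u v ≡ true → ⊥
  disjoint {i} {suc j} {u} {v} 1≤i (s≤s i≤j) j<k ei ej
    with trans (sym (proj₁ (proj₂ (seq (suc j) (s≤s z≤n) j<k)) u v ej)) (removed j 1≤i i≤j ei)
  ... | ()

  edge-index : ∀ {j j′ u v} → 1 ≤ j → j ≤ k → 1 ≤ j′ → j′ ≤ k
    → M j u v ≡ true → M j′ u v ≡ true → j ≡ j′
  edge-index {j} {j′} 1≤j j≤k 1≤j′ j′≤k e e′ with <-cmp j j′
  ... | tri< j<j′ _ _ = ⊥-elim (disjoint 1≤j j<j′ j′≤k e e′)
  ... | tri≈ _ j≡j′ _ = j≡j′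
  ... | tri> _ _ j′<j = ⊥-elim (disjoint 1≤j′ j′<j j≤k e′ e)

  module _ (2≤k : 2 ≤ k) where

    H : ℕ → Rel n
    H j = union3 (M 1) (M 2) (M j)

    private
      M₁ : IsMatchingRel (M 1)
      M₁ = matching (s≤s z≤n) (≤-trans (s≤s z≤n) 2≤k)
      M₂ : IsMatchingRel (M 2)
      M₂ = matching (s≤s z≤n) 2≤k

      end : Fin n → Fin n
      end v = let (a , _) = IsMatchingRel.total M₁ v
                  (r , _) = IsMatchingRel.total M₂ a
              in  proj₁ (IsMatchingRel.total M₁ r)

    closing-edge : ∀ {j S v} → IsK33Component (H j) S → v ∈ S → M j v (end v) ≡ true
    closing-edge {v = v} comp v∈S =
      let (a , va) = IsMatchingRel.total M₁ v
          (r , ar) = IsMatchingRel.total M₂ a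
          (_ , rs) = IsMatchingRel.total M₁ r
      in  alternating-path (M 1) (M 2) _ M₁ M₂ (disjoint (s≤s z≤n) (s≤s (s≤s z≤n)) 2≤k)
            comp v∈S va ar rs

    index-unique : ∀ {j j′ S S′ v} → 3 ≤ j → j ≤ k → 3 ≤ j′ → j′ ≤ k
      → IsK33Component (H j) S → IsK33Component (H j′) S′ → v ∈ S → v ∈ S′ → j ≡ j′
    index-unique 3≤j j≤k 3≤j′ j′≤k comp comp′ v∈S v∈S′ =
      edge-index (≤-trans (s≤s z≤n) 3≤j) j≤k (≤-trans (s≤s z≤n) 3≤j′) j′≤k
        (closing-edge comp v∈S) (closing-edge comp′ v∈S′)

module ChosenComponents {n} (k : ℕ) (G : Rel n) (M : ℕ → Rel n)
  (seq : IsMatchingSequence k G M) (2≤k : 2 ≤ k) (cnt : ℕ → ℕ)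
  (counts : ∀ j → 3 ≤ j → j ≤ k → NumK33Components (union3 (M 1) (M 2) (M j)) (cnt j))
  (c : ℕ) (c≤cnt : ∀ j → 3 ≤ j → j ≤ k → c ≤ cnt j) where

  open MatchingSequence k G M seq

  index : Fin (k ∸ 2) → ℕ
  index t = 3 + toℕ t

  3≤index : ∀ t → 3 ≤ index t
  3≤index t = m≤m+n 3 (toℕ t)

  index≤k : ∀ t → index t ≤ k
  index≤k t = subst (index t ≤_) (m+[n∸m]≡n 2≤k) (+-monoʳ-≤ 2 (toℕ<n t))

  enumeration : ∀ t → NumK33Components (H 2≤k (index t)) (cnt (index t))
  enumeration t = counts (index t) (3≤index t) (index≤k t)

  listing : Fin (k ∸ 2) → List (Subset n)
  listing t = proj₁ (enumeration t)

  position : ∀ t → Fin c → Fin (length (listing t))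
  position t p = inject≤ p (subst (c ≤_) (sym length≡) (c≤cnt (index t) (3≤index t) (index≤k t)))
    where length≡ = proj₁ (proj₂ (proj₂ (enumeration t)))

  component : Fin (k ∸ 2) → Fin c → Subset n
  component t p = lookup (listing t) (position t p)

  component-K33 : ∀ t p → IsK33Component (H 2≤k (index t)) (component t p)
  component-K33 t p =
    Equivalence.to (proj₂ (proj₂ (proj₂ (enumeration t))) _) (∈-lookup (position t p))

  vertex : Fin 6 → Fin (k ∸ 2) → Fin c → Fin n
  vertex a t p = proj₁ (proj₂ (component-K33 t p)) a

  vertex∈component : ∀ a t p → vertex a t p ∈ component t p
  vertex∈component a t p = proj₁ (proj₂ (proj₂ (proj₂ (proj₂ (component-K33 t p))))) a

  -- A shared vertex means the same index (components of distinct H_j are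
  -- disjoint), then the same component, then the same vertex of it.
  same-index : ∀ {a a′ t t′ p p′} → vertex a t p ≡ vertex a′ t′ p′ → t ≡ t′
  same-index {a} {a′} {t} {t′} {p} {p′} e =
    toℕ-injective (+-cancelˡ-≡ 3 _ _
      (index-unique 2≤k (3≤index t) (index≤k t) (3≤index t′) (index≤k t′)
        (component-K33 t p) (component-K33 t′ p′) (vertex∈component a t p)
        (subst (_∈ component t′ p′) (sym e) (vertex∈component a′ t′ p′))))

  same-position : ∀ {a a′ t p p′} → vertex a t p ≡ vertex a′ t p′ → p ≡ p′
  same-position {a} {a′} {t} {p} {p′} e =
    inject≤-injective _ _ p p′
      (lookup-injective (listing t) (proj₁ (proj₂ (enumeration t))) (position t p) (position t p′)
        (same-component (proj₁ (component-K33 t p)) (proj₁ (component-K33 t p′))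
          (vertex∈component a t p)
          (subst (_∈ component t p′) (sym e) (vertex∈component a′ t p′))))

  same-vertex : ∀ {a a′ t p} → vertex a t p ≡ vertex a′ t p → a ≡ a′
  same-vertex {a} {a′} {t} {p} = proj₁ (proj₂ (proj₂ (component-K33 t p))) a a′

  same-block : ∀ {a t p a′ t′ p′} → t ≡ t′ → vertex a t p ≡ vertex a′ t′ p′
    → a ≡ a′ × t ≡ t′ × p ≡ p′
  same-block refl e = same-listed (same-position e) e
    where
    same-listed : ∀ {a t p a′ p′} → p ≡ p′ → vertex a t p ≡ vertex a′ t p′
      → a ≡ a′ × t ≡ t × p ≡ p′
    same-listed refl e = same-vertex e , refl , refl

  vertex-injective : ∀ {a t p a′ t′ p′} → vertex a t p ≡ vertex a′ t′ p′
    → a ≡ a′ × t ≡ t′ × p ≡ p′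
  vertex-injective e = same-block (same-index e) e

  bound : 6 * (k ∸ 2) * c ≤ n
  bound = injective₃⇒≤ vertex vertex-injective

-- The theorem: with c = cnt i minimal, the 6·(k-2)·c vertices of the
-- chosen components are distinct.  (Simplicity, bipartiteness and
-- regularity of G are only needed for the matchings to exist.)
lemma2 : (k n : ℕ) (G : Rel n) → 4 ≤ k → IsSimple G → Bipartite G → Regular k G
    → (M : ℕ → Rel n) → IsMatchingSequence k G M
    → (cnt : ℕ → ℕ)
    → (∀ j → 3 ≤ j → j ≤ k → NumK33Components (union3 (M 1) (M 2) (M j)) (cnt j))
    → (i : ℕ) → 3 ≤ i → i ≤ k
    → (∀ j → 3 ≤ j → j ≤ k → cnt i ≤ cnt j)
    → 6 * (k ∸ 2) * cnt i ≤ n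
lemma2 k n G 4≤k _ _ _ M seq cnt counts i _ _ minimal =
  ChosenComponents.bound k G M seq (≤-trans (s≤s (s≤s z≤n)) 4≤k) cnt counts (cnt i) minimal
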